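{- For $n\ge 2$, let $G_n$ be the graph obtained from $n$ pairwise disjoint $5$-cycles by selecting one edge in each of them and identifying these $n$ edges into a single edge $uv$. Then $\mu_{\rm d}(G_n)=2$.
   Context: For a graph $G$ and $X\subseteq V(G)$, two vertices $x,y$ are $X$-visible if there is a shortest $x,y$-path in $G$ with no internal vertex in $X$. $X$ is a dual mutual-visibility set if any two vertices of $X$ are $X$-visible and any two vertices of $V(G)\setminus X$ are $X$-visible. $\mu_{\rm d}(G)$ denotes the maximum cardinality of a dual mutual-visibility set of $G$. -}

module Defs where

open import Data.Nat using (ℕ; zero; suc; _+_; _*_; _≤_; _<_)
open import Data.Fin using (Fin; toℕ)
open import Data.Fin.Subset using (Subset; _∈_; _∉_; ∣_∣)
open import Data.Product using (Σ; _×_; _,_)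
open import Data.Sum using (_⊎_)
open import Data.Unit using (⊤)
open import Relation.Binary.PropositionalEquality using (_≡_)

module _ {N : ℕ} (Adj : Fin N → Fin N → Set) where

  data Walk : Fin N → Fin N → Set where
    stop : (x : Fin N) → Walk x x
    step : (x : Fin N) {y z : Fin N} → Adj x y → Walk y z → Walk x z

  len : {x y : Fin N} → Walk x y → ℕ
  len (stop _)     = 0
  len (step _ _ w) = suc (len w)

  IsShortest : {x y : Fin N} → Walk x y → Set
  IsShortest {x} {y} w = (w' : Walk x y) → len w ≤ len w'

  AllButLastOutside : Subset N → {y z : Fin N} → Walk y z → Set
  AllButLastOutside X (stop _)       = ⊤
  AllButLastOutside X (step y _ w)   = (y ∉ X) × AllButLastOutside X w

  NoInternalIn : Subset N → {x y : Fin N} → Walk x y → Set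
  NoInternalIn X (stop _)     = ⊤
  NoInternalIn X (step _ _ w) = AllButLastOutside X w

  Visible : Subset N → Fin N → Fin N → Set
  Visible X x y = Σ (Walk x y) λ w → IsShortest w × NoInternalIn X w

  IsDualMV : Subset N → Set
  IsDualMV X =
    ((x y : Fin N) → x ∈ X → y ∈ X → Visible X x y) ×
    ((x y : Fin N) → x ∉ X → y ∉ X → Visible X x y)

  μd≡ : ℕ → Set
  μd≡ k = (Σ (Subset N) λ X → IsDualMV X × ∣ X ∣ ≡ k) ×
          ((X : Subset N) → IsDualMV X → ∣ X ∣ ≤ k)

-- Vertices are Fin (2 + 3 * n): 0 = u, 1 = v, and for cycle i < n the
-- three remaining vertices a_i, b_i, c_i are 2+3i, 3+3i, 4+3i; the i-th
-- 5-cycle is u a_i b_i c_i v u.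

data GEdge (n : ℕ) : ℕ → ℕ → Set where
  e-uv : GEdge n 0 1
  e-ua : (i : ℕ) → i < n → GEdge n 0 (2 + 3 * i)
  e-ab : (i : ℕ) → i < n → GEdge n (2 + 3 * i) (3 + 3 * i)
  e-bc : (i : ℕ) → i < n → GEdge n (3 + 3 * i) (4 + 3 * i)
  e-cv : (i : ℕ) → i < n → GEdge n (4 + 3 * i) 1

GAdj : (n : ℕ) → Fin (2 + 3 * n) → Fin (2 + 3 * n) → Set
GAdj n x y = GEdge n (toℕ x) (toℕ y) ⊎ GEdge n (toℕ y) (toℕ x)

-- The distance of G_n is the explicit table `dist`: it changes by at most one along each edge
-- and is attained by explicit routes, so a walk is shortest exactly when its length is `dist`.
-- Lower bound: a₀b₀ is an edge, and the chosen geodesics between vertices other than a₀, b₀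
-- avoid both, so {a₀, b₀} is a dual mutual-visibility set.
-- Upper bound: let X be a dual mutual-visibility set. Two of a₀, a₁, v lie on the same side of X
-- and all geodesics between them pass through u, so u ∉ X; likewise v ∉ X. The only geodesic
-- from u to b_i passes through a_i, so a_i ∈ X forces b_i ∈ X, and symmetrically c_i ∈ X forces
-- b_i ∈ X. The geodesic from a_i to c_i passes through b_i, so b_i ∈ X forces exactly one of
-- a_i, c_i into X. Two vertices b_i ≠ b_j in X are ruled out by the geodesics a_i–b_j, c_i–b_j
-- or b_i–b_j. Hence X ⊆ {a_i, b_i} or X ⊆ {b_i, c_i} for a single i.

module Submission where

open import Defs
open import Data.Bool.Base using (if_then_else_; T; _∧_)
open import Data.Bool.Properties using (T-∧)
open import Data.Empty using (⊥; ⊥-elim)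
open import Data.Fin.Base using (Fin; toℕ; fromℕ<) renaming (zero to fzero; suc to fsuc)
open import Data.Fin.Properties using (toℕ-injective; toℕ-fromℕ<; toℕ<n; suc-injective)
open import Data.Fin.Subset using (Subset; _∈_; _∉_; ∣_∣; inside; outside; Empty) renaming (⊥ to ∅)
open import Data.Fin.Subset.Properties using (∉⊥; ∣⊥∣≡0; _∈?_; Empty-unique)
open import Data.Nat.Base using (ℕ; zero; suc; _+_; _*_; _≤_; _<_; z≤n; s≤s; _≤ᵇ_)
open import Data.Nat.Properties
  using (_≟_; ≤-trans; ≤-reflexive; ≤-antisym; ≤ᵇ⇒≤; *-suc; *-monoʳ-≤; *-cancelˡ-<; m≤n+m; n≤1+n)
open import Data.Product using (Σ; ∃; _×_; _,_; proj₁; proj₂)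
open import Data.Sum using (_⊎_; inj₁; inj₂; [_,_])
import Data.Sum as Sum
open import Data.Unit using (⊤; tt)
open import Data.Vec.Base using ([]; _∷_; here; there)
open import Function.Base using (_∘_)
open import Function.Bundles using (Equivalence)
open import Relation.Binary.PropositionalEquality
  using (_≡_; _≢_; refl; sym; trans; cong; subst; subst₂)
open import Relation.Nullary using (Dec; yes; no; ¬_; does)
open import Relation.Nullary.Decidable using (decidable-stable)

TwoEqual : ∀ {A : Set} → A → A → A → Set
TwoEqual x y z = x ≡ y ⊎ x ≡ z ⊎ y ≡ z

TwoEqual-injective : ∀ {A B : Set} {f : A → B} → (∀ {x y} → f x ≡ f y → x ≡ y) →
                     ∀ {x y z} → TwoEqual (f x) (f y) (f z) → TwoEqual x y z
TwoEqual-injective f-injective = Sum.map f-injective (Sum.map f-injective f-injective)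

pigeonhole-pair : ∀ {A : Set} {p q x y z : A} →
                  x ≡ p ⊎ x ≡ q → y ≡ p ⊎ y ≡ q → z ≡ p ⊎ z ≡ q → TwoEqual x y z
pigeonhole-pair (inj₁ refl) (inj₁ refl) _           = inj₁ refl
pigeonhole-pair (inj₂ refl) (inj₂ refl) _           = inj₁ refl
pigeonhole-pair (inj₁ refl) (inj₂ refl) (inj₁ refl) = inj₂ (inj₁ refl)
pigeonhole-pair (inj₁ refl) (inj₂ refl) (inj₂ refl) = inj₂ (inj₂ refl)
pigeonhole-pair (inj₂ refl) (inj₁ refl) (inj₁ refl) = inj₂ (inj₂ refl)
pigeonhole-pair (inj₂ refl) (inj₁ refl) (inj₂ refl) = inj₂ (inj₁ refl)

Agree : Set → Set → Set
Agree A B = (A × B) ⊎ (¬ A × ¬ B)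

pigeonhole-dec : ∀ {A B C : Set} → Dec A → Dec B → Dec C → Agree A B ⊎ Agree A C ⊎ Agree B C
pigeonhole-dec (yes a) (yes b) _       = inj₁ (inj₁ (a , b))
pigeonhole-dec (no ¬a) (no ¬b) _       = inj₁ (inj₂ (¬a , ¬b))
pigeonhole-dec (yes a) (no ¬b) (yes c) = inj₂ (inj₁ (inj₁ (a , c)))
pigeonhole-dec (yes a) (no ¬b) (no ¬c) = inj₂ (inj₂ (inj₂ (¬b , ¬c)))
pigeonhole-dec (no ¬a) (yes b) (yes c) = inj₂ (inj₂ (inj₁ (b , c)))
pigeonhole-dec (no ¬a) (yes b) (no ¬c) = inj₂ (inj₁ (inj₂ (¬a , ¬c)))

Empty⇒∣p∣≡0 : ∀ {m} (p : Subset m) → Empty p → ∣ p ∣ ≡ 0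
Empty⇒∣p∣≡0 {m} p empty = trans (cong ∣_∣ (Empty-unique empty)) (∣⊥∣≡0 m)

∣p∣≤1 : ∀ {m} (p : Subset m) → (∀ {x y} → x ∈ p → y ∈ p → x ≡ y) → ∣ p ∣ ≤ 1
∣p∣≤1 []            _    = z≤n
∣p∣≤1 (outside ∷ p) same = ∣p∣≤1 p λ x∈ y∈ → suc-injective (same (there x∈) (there y∈))
∣p∣≤1 (inside ∷ p)  same =
  s≤s (≤-reflexive (Empty⇒∣p∣≡0 p λ (_ , x∈) → 0≢suc (same here (there x∈))))
  where
  0≢suc : ∀ {m} {x : Fin m} → fzero ≢ fsuc x
  0≢suc ()

∣p∣≤2 : ∀ {m} (p : Subset m) → (∀ {x y z} → x ∈ p → y ∈ p → z ∈ p → TwoEqual x y z) → ∣ p ∣ ≤ 2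
∣p∣≤2 []            _   = z≤n
∣p∣≤2 (outside ∷ p) two =
  ∣p∣≤2 p λ x∈ y∈ z∈ →
    TwoEqual-injective {f = fsuc} suc-injective (two (there x∈) (there y∈) (there z∈))
∣p∣≤2 (inside ∷ p)  two = s≤s (∣p∣≤1 p λ x∈ y∈ → tail-equal (two here (there x∈) (there y∈)))
  where
  tail-equal : ∀ {m} {x y : Fin m} → TwoEqual fzero (fsuc x) (fsuc y) → x ≡ y
  tail-equal (inj₂ (inj₂ e)) = suc-injective e

data Node : Set where
  u v   : Node
  a b c : ℕ → Node

index : Node → ℕ
index u     = 0
index v     = 1
index (a i) = 2 + 3 * i
index (b i) = 3 + 3 * i
index (c i) = 4 + 3 * i

Valid : ℕ → Node → Set
Valid n u     = ⊤
Valid n v     = ⊤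
Valid n (a i) = i < n
Valid n (b i) = i < n
Valid n (c i) = i < n

data Role : Set where
  first second third : Role

onCycle : Role → ℕ → Node
onCycle first  i = a i
onCycle second i = b i
onCycle third  i = c i

offset : Role → ℕ
offset first  = 0
offset second = 1
offset third  = 2

position : ℕ → Role × ℕ
position 0                   = first  , 0
position 1                   = second , 0
position 2                   = third  , 0
position (suc (suc (suc m))) with position m
... | r , i = r , suc i

node : ℕ → Node
node 0             = u
node 1             = v
node (suc (suc m)) with position m
... | r , i = onCycle r i

offset+3*suc : ∀ r i → offset r + 3 * suc i ≡ 3 + (offset r + 3 * i)
offset+3*suc first  i = *-suc 3 i
offset+3*suc second i = cong suc (*-suc 3 i)
offset+3*suc third  i = cong (2 +_) (*-suc 3 i)

offset+3*-position : ∀ m → offset (proj₁ (position m)) + 3 * proj₂ (position m) ≡ m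
offset+3*-position 0 = refl
offset+3*-position 1 = refl
offset+3*-position 2 = refl
offset+3*-position (suc (suc (suc m))) with position m | offset+3*-position m
... | r , i | eq = trans (offset+3*suc r i) (cong (3 +_) eq)

position-offset+3* : ∀ r i → position (offset r + 3 * i) ≡ (r , i)
position-offset+3* first  zero = refl
position-offset+3* second zero = refl
position-offset+3* third  zero = refl
position-offset+3* r (suc i) rewrite offset+3*suc r i | position-offset+3* r i = refl

index-onCycle : ∀ r i → index (onCycle r i) ≡ 2 + (offset r + 3 * i)
index-onCycle first  i = refl
index-onCycle second i = refl
index-onCycle third  i = refl

index-node : ∀ m → index (node m) ≡ m
index-node 0             = refl
index-node 1             = refl
index-node (suc (suc m)) with position m | offset+3*-position m
... | r , i | eq = trans (index-onCycle r i) (cong (2 +_) eq)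

node-index : ∀ p → node (index p) ≡ p
node-index u     = refl
node-index v     = refl
node-index (a i) rewrite position-offset+3* first  i = refl
node-index (b i) rewrite position-offset+3* second i = refl
node-index (c i) rewrite position-offset+3* third  i = refl

data Edge : Node → Node → Set where
  uv : Edge u v
  ua : ∀ i → Edge u (a i)
  ab : ∀ i → Edge (a i) (b i)
  bc : ∀ i → Edge (b i) (c i)
  cv : ∀ i → Edge (c i) v

Adjacent : Node → Node → Set
Adjacent p q = Edge p q ⊎ Edge q p

pattern fwd e = inj₁ e
pattern bwd e = inj₂ e

-- Opaque, so that `with i ≟ᶜ j` can abstract the comparisons to which `dist` unfolds.
opaque
  _≟ᶜ_ : (i j : ℕ) → Dec (i ≡ j)
  _≟ᶜ_ = _≟_

dist : Node → Node → ℕ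
dist u     u     = 0
dist u     v     = 1
dist u     (a j) = 1
dist u     (b j) = 2
dist u     (c j) = 2
dist v     u     = 1
dist v     v     = 0
dist v     (a j) = 2
dist v     (b j) = 2
dist v     (c j) = 1
dist (a i) u     = 1
dist (a i) v     = 2
dist (a i) (a j) = if does (i ≟ᶜ j) then 0 else 2
dist (a i) (b j) = if does (i ≟ᶜ j) then 1 else 3
dist (a i) (c j) = if does (i ≟ᶜ j) then 2 else 3
dist (b i) u     = 2
dist (b i) v     = 2
dist (b i) (a j) = if does (i ≟ᶜ j) then 1 else 3
dist (b i) (b j) = if does (i ≟ᶜ j) then 0 else 4
dist (b i) (c j) = if does (i ≟ᶜ j) then 1 else 3
dist (c i) u     = 2
dist (c i) v     = 1
dist (c i) (a j) = if does (i ≟ᶜ j) then 2 else 3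
dist (c i) (b j) = if does (i ≟ᶜ j) then 1 else 3
dist (c i) (c j) = if does (i ≟ᶜ j) then 0 else 2

if-≟ᶜ-refl : ∀ i (x y : ℕ) → (if does (i ≟ᶜ i) then x else y) ≡ x
if-≟ᶜ-refl i x y with i ≟ᶜ i
... | yes _   = refl
... | no i≢i = ⊥-elim (i≢i refl)

if-≟ᶜ-≢ : ∀ {i j} → i ≢ j → (x y : ℕ) → (if does (i ≟ᶜ j) then x else y) ≡ y
if-≟ᶜ-≢ {i} {j} i≢j x y with i ≟ᶜ j
... | yes i≡j = ⊥-elim (i≢j i≡j)
... | no _    = refl

dist-self : ∀ p → dist p p ≡ 0
dist-self u     = refl
dist-self v     = refl
dist-self (a i) = if-≟ᶜ-refl i 0 2
dist-self (b i) = if-≟ᶜ-refl i 0 4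
dist-self (c i) = if-≟ᶜ-refl i 0 2

dist-edgeᵇ : ∀ {p q} → Edge p q → ∀ r →
             T ((dist p r ≤ᵇ suc (dist q r)) ∧ (dist q r ≤ᵇ suc (dist p r)))
dist-edgeᵇ uv     u     = tt
dist-edgeᵇ uv     v     = tt
dist-edgeᵇ uv     (a j) = tt
dist-edgeᵇ uv     (b j) = tt
dist-edgeᵇ uv     (c j) = tt
dist-edgeᵇ (ua i) u     = tt
dist-edgeᵇ (ua i) v     = tt
dist-edgeᵇ (ua i) (a j) with i ≟ᶜ j
... | yes _ = tt
... | no _  = tt
dist-edgeᵇ (ua i) (b j) with i ≟ᶜ j
... | yes _ = tt
... | no _  = tt
dist-edgeᵇ (ua i) (c j) with i ≟ᶜ j
... | yes _ = tt
... | no _  = tt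
dist-edgeᵇ (ab i) u     = tt
dist-edgeᵇ (ab i) v     = tt
dist-edgeᵇ (ab i) (a j) with i ≟ᶜ j
... | yes _ = tt
... | no _  = tt
dist-edgeᵇ (ab i) (b j) with i ≟ᶜ j
... | yes _ = tt
... | no _  = tt
dist-edgeᵇ (ab i) (c j) with i ≟ᶜ j
... | yes _ = tt
... | no _  = tt
dist-edgeᵇ (bc i) u     = tt
dist-edgeᵇ (bc i) v     = tt
dist-edgeᵇ (bc i) (a j) with i ≟ᶜ j
... | yes _ = tt
... | no _  = tt
dist-edgeᵇ (bc i) (b j) with i ≟ᶜ j
... | yes _ = tt
... | no _  = tt
dist-edgeᵇ (bc i) (c j) with i ≟ᶜ j
... | yes _ = tt
... | no _  = tt
dist-edgeᵇ (cv i) u     = tt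
dist-edgeᵇ (cv i) v     = tt
dist-edgeᵇ (cv i) (a j) with i ≟ᶜ j
... | yes _ = tt
... | no _  = tt
dist-edgeᵇ (cv i) (b j) with i ≟ᶜ j
... | yes _ = tt
... | no _  = tt
dist-edgeᵇ (cv i) (c j) with i ≟ᶜ j
... | yes _ = tt
... | no _  = tt

dist-adjacent : ∀ {p q} → Adjacent p q → ∀ r → dist p r ≤ suc (dist q r)
dist-adjacent {p} {q} (fwd e) r = ≤ᵇ⇒≤ (dist p r) _ (proj₁ (Equivalence.to T-∧ (dist-edgeᵇ e r)))
dist-adjacent {p} {q} (bwd e) r = ≤ᵇ⇒≤ (dist p r) _ (proj₂ (Equivalence.to T-∧ (dist-edgeᵇ e r)))

data Route (n : ℕ) : Node → Node → Set where
  end : ∀ {p} → Route n p p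
  hop : ∀ {p q r} → Adjacent p q → Valid n q → Route n q r → Route n p r

module _ {n : ℕ} where

  length : ∀ {p q} → Route n p q → ℕ
  length end         = 0
  length (hop _ _ ρ) = suc (length ρ)

  AllButLast : (Node → Set) → ∀ {p q} → Route n p q → Set
  AllButLast Q end                 = ⊤
  AllButLast Q (hop {p = p} _ _ ρ) = Q p × AllButLast Q ρ

  AllInterior : (Node → Set) → ∀ {p q} → Route n p q → Set
  AllInterior Q end         = ⊤
  AllInterior Q (hop _ _ ρ) = AllButLast Q ρ

  dist≤length : ∀ {p q} (ρ : Route n p q) → dist p q ≤ length ρ
  dist≤length {p} end = ≤-reflexive (dist-self p)
  dist≤length {q = r} (hop e _ ρ) = ≤-trans (dist-adjacent e r) (s≤s (dist≤length ρ))

  record GeodesicWithin (Q : Node → Set) (p q : Node) : Set where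
    constructor geodesicWithin
    field
      path          : Route n p q
      path-length   : length path ≡ dist p q
      path-interior : AllInterior Q path

  Geodesic : Node → Node → Set
  Geodesic p q = Σ (Route n p q) λ ρ → length ρ ≡ dist p q


  geodesic : ∀ p q → Valid n p → Valid n q → Geodesic p q
  geodesic u     u     _  _  = end , refl
  geodesic u     v     _  _  = hop (fwd uv) tt end , refl
  geodesic u     (a j) _  vq = hop (fwd (ua j)) vq end , refl
  geodesic u     (b j) _  vq = hop (fwd (ua j)) vq (hop (fwd (ab j)) vq end) , refl
  geodesic u     (c j) _  vq = hop (fwd uv) tt (hop (bwd (cv j)) vq end) , refl
  geodesic v     u     _  _  = hop (bwd uv) tt end , refl
  geodesic v     v     _  _  = end , refl
  geodesic v     (a j) _  vq = hop (bwd uv) tt (hop (fwd (ua j)) vq end) , refl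
  geodesic v     (b j) _  vq = hop (bwd (cv j)) vq (hop (bwd (bc j)) vq end) , refl
  geodesic v     (c j) _  vq = hop (bwd (cv j)) vq end , refl
  geodesic (a i) u     _  _  = hop (bwd (ua i)) tt end , refl
  geodesic (a i) v     _  _  = hop (bwd (ua i)) tt (hop (fwd uv) tt end) , refl
  geodesic (a i) (a j) vp vq with i ≟ᶜ j
  ... | yes refl = end , refl
  ... | no _     = hop (bwd (ua i)) tt (hop (fwd (ua j)) vq end) , refl
  geodesic (a i) (b j) vp vq with i ≟ᶜ j
  ... | yes refl = hop (fwd (ab i)) vp end , refl
  ... | no _     = hop (bwd (ua i)) tt (hop (fwd (ua j)) vq (hop (fwd (ab j)) vq end)) , refl
  geodesic (a i) (c j) vp vq with i ≟ᶜ j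
  ... | yes refl = hop (fwd (ab i)) vp (hop (fwd (bc i)) vp end) , refl
  ... | no _     = hop (bwd (ua i)) tt (hop (fwd uv) tt (hop (bwd (cv j)) vq end)) , refl
  geodesic (b i) u     vp _  = hop (bwd (ab i)) vp (hop (bwd (ua i)) tt end) , refl
  geodesic (b i) v     vp _  = hop (fwd (bc i)) vp (hop (fwd (cv i)) tt end) , refl
  geodesic (b i) (a j) vp vq with i ≟ᶜ j
  ... | yes refl = hop (bwd (ab i)) vp end , refl
  ... | no _     = hop (bwd (ab i)) vp (hop (bwd (ua i)) tt (hop (fwd (ua j)) vq end)) , refl
  geodesic (b i) (b j) vp vq with i ≟ᶜ j
  ... | yes refl = end , refl
  ... | no _     = hop (fwd (bc i)) vp (hop (fwd (cv i)) tt
                     (hop (bwd (cv j)) vq (hop (bwd (bc j)) vq end))) , refl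
  geodesic (b i) (c j) vp vq with i ≟ᶜ j
  ... | yes refl = hop (fwd (bc i)) vp end , refl
  ... | no _     = hop (fwd (bc i)) vp (hop (fwd (cv i)) tt (hop (bwd (cv j)) vq end)) , refl
  geodesic (c i) u     _  _  = hop (fwd (cv i)) tt (hop (bwd uv) tt end) , refl
  geodesic (c i) v     _  _  = hop (fwd (cv i)) tt end , refl
  geodesic (c i) (a j) vp vq with i ≟ᶜ j
  ... | yes refl = hop (bwd (bc i)) vp (hop (bwd (ab i)) vp end) , refl
  ... | no _     = hop (fwd (cv i)) tt (hop (bwd uv) tt (hop (fwd (ua j)) vq end)) , refl
  geodesic (c i) (b j) vp vq with i ≟ᶜ j
  ... | yes refl = hop (bwd (bc i)) vp end , refl
  ... | no _     = hop (fwd (cv i)) tt (hop (bwd (cv j)) vq (hop (bwd (bc j)) vq end)) , refl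
  geodesic (c i) (c j) vp vq with i ≟ᶜ j
  ... | yes refl = end , refl
  ... | no _     = hop (fwd (cv i)) tt (hop (bwd (cv j)) vq end) , refl

module _ {n : ℕ} {Q : Node → Set} where

  a-a-via-u : ∀ {i j} → i ≢ j → GeodesicWithin {n} Q (a i) (a j) → Q u
  a-a-via-u {i} {j} i≢j (geodesicWithin ρ ℓ interior) = go ρ (trans ℓ (if-≟ᶜ-≢ i≢j 0 2)) interior
    where
    go : (ρ : Route n (a i) (a j)) → length ρ ≡ 2 → AllInterior Q ρ → Q u
    go (hop (bwd (ua _)) _ (hop _ _ end))            _ (Qu , _) = Qu
    go (hop (fwd (ab _)) _ (hop (bwd (ab _)) _ end)) _ _        = ⊥-elim (i≢j refl)

  a-v-via-u : ∀ {i} → GeodesicWithin {n} Q (a i) v → Q u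
  a-v-via-u (geodesicWithin (hop (bwd (ua _)) _ (hop _ _ end)) _ (Qu , _)) = Qu
  a-v-via-u (geodesicWithin (hop (fwd (ab _)) _ (hop (fwd ()) _ end)) _ _)
  a-v-via-u (geodesicWithin (hop (fwd (ab _)) _ (hop (bwd ()) _ end)) _ _)

  c-c-via-v : ∀ {i j} → i ≢ j → GeodesicWithin {n} Q (c i) (c j) → Q v
  c-c-via-v {i} {j} i≢j (geodesicWithin ρ ℓ interior) = go ρ (trans ℓ (if-≟ᶜ-≢ i≢j 0 2)) interior
    where
    go : (ρ : Route n (c i) (c j)) → length ρ ≡ 2 → AllInterior Q ρ → Q v
    go (hop (fwd (cv _)) _ (hop _ _ end))            _ (Qv , _) = Qv
    go (hop (bwd (bc _)) _ (hop (fwd (bc _)) _ end)) _ _        = ⊥-elim (i≢j refl)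

  c-u-via-v : ∀ {i} → GeodesicWithin {n} Q (c i) u → Q v
  c-u-via-v (geodesicWithin (hop (fwd (cv _)) _ (hop _ _ end)) _ (Qv , _)) = Qv
  c-u-via-v (geodesicWithin (hop (bwd (bc _)) _ (hop (fwd ()) _ end)) _ _)
  c-u-via-v (geodesicWithin (hop (bwd (bc _)) _ (hop (bwd ()) _ end)) _ _)

  u-b-via-a : ∀ {i} → GeodesicWithin {n} Q u (b i) → Q (a i)
  u-b-via-a (geodesicWithin (hop (fwd (ua _)) _ (hop (fwd (ab _)) _ end)) _ (Qa , _)) = Qa
  u-b-via-a (geodesicWithin (hop (fwd uv) _ (hop (fwd ()) _ end)) _ _)
  u-b-via-a (geodesicWithin (hop (fwd uv) _ (hop (bwd ()) _ end)) _ _)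

  v-b-via-c : ∀ {i} → GeodesicWithin {n} Q v (b i) → Q (c i)
  v-b-via-c (geodesicWithin (hop (bwd (cv _)) _ (hop (bwd (bc _)) _ end)) _ (Qc , _)) = Qc
  v-b-via-c (geodesicWithin (hop (bwd uv) _ (hop (fwd ()) _ end)) _ _)
  v-b-via-c (geodesicWithin (hop (bwd uv) _ (hop (bwd ()) _ end)) _ _)

  a-c-via-b : ∀ {i} → GeodesicWithin {n} Q (a i) (c i) → Q (b i)
  a-c-via-b {i} (geodesicWithin ρ ℓ interior) = go ρ (trans ℓ (if-≟ᶜ-refl i 2 3)) interior
    where
    go : (ρ : Route n (a i) (c i)) → length ρ ≡ 2 → AllInterior Q ρ → Q (b i)
    go (hop (fwd (ab _)) _ (hop (fwd (bc _)) _ end)) _ (Qb , _) = Qb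
    go (hop (bwd (ua _)) _ (hop (fwd ()) _ end)) _ _
    go (hop (bwd (ua _)) _ (hop (bwd ()) _ end)) _ _

  a-b-via-a : ∀ {i j} → i ≢ j → GeodesicWithin {n} Q (a i) (b j) → Q (a j)
  a-b-via-a {i} {j} i≢j (geodesicWithin ρ ℓ interior) = go ρ (trans ℓ (if-≟ᶜ-≢ i≢j 1 3)) interior
    where
    go : (ρ : Route n (a i) (b j)) → length ρ ≡ 3 → AllInterior Q ρ → Q (a j)
    go (hop (bwd (ua _)) _ (hop (fwd (ua _)) _ (hop (fwd (ab _)) _ end))) _ (_ , Qa , _) = Qa
    go (hop (bwd (ua _)) _ (hop (fwd uv) _ (hop (fwd ()) _ end))) _ _
    go (hop (bwd (ua _)) _ (hop (fwd uv) _ (hop (bwd ()) _ end))) _ _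
    go (hop (fwd (ab _)) _ (hop (bwd (ab _)) _ (hop (fwd (ab _)) _ end))) _ _ = ⊥-elim (i≢j refl)
    go (hop (fwd (ab _)) _ (hop (fwd (bc _)) _ (hop (bwd (bc _)) _ end))) _ _ = ⊥-elim (i≢j refl)

  c-b-via-c : ∀ {i j} → i ≢ j → GeodesicWithin {n} Q (c i) (b j) → Q (c j)
  c-b-via-c {i} {j} i≢j (geodesicWithin ρ ℓ interior) = go ρ (trans ℓ (if-≟ᶜ-≢ i≢j 1 3)) interior
    where
    go : (ρ : Route n (c i) (b j)) → length ρ ≡ 3 → AllInterior Q ρ → Q (c j)
    go (hop (fwd (cv _)) _ (hop (bwd (cv _)) _ (hop (bwd (bc _)) _ end))) _ (_ , Qc , _) = Qc
    go (hop (fwd (cv _)) _ (hop (bwd uv) _ (hop (fwd ()) _ end))) _ _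
    go (hop (fwd (cv _)) _ (hop (bwd uv) _ (hop (bwd ()) _ end))) _ _
    go (hop (bwd (bc _)) _ (hop (bwd (ab _)) _ (hop (fwd (ab _)) _ end))) _ _ = ⊥-elim (i≢j refl)
    go (hop (bwd (bc _)) _ (hop (fwd (bc _)) _ (hop (bwd (bc _)) _ end))) _ _ = ⊥-elim (i≢j refl)

  b-b-via-a⊎c : ∀ {i j} → i ≢ j → GeodesicWithin {n} Q (b i) (b j) → Q (a i) ⊎ Q (c j)
  b-b-via-a⊎c {i} {j} i≢j (geodesicWithin ρ ℓ interior) = go ρ (trans ℓ (if-≟ᶜ-≢ i≢j 0 4)) interior
    where
    go : (ρ : Route n (b i) (b j)) → length ρ ≡ 4 → AllInterior Q ρ → Q (a i) ⊎ Q (c j)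
    go (hop (bwd (ab _)) _ (hop _ _ _)) _ (Qa , _) = inj₁ Qa
    go (hop (fwd (bc _)) _ (hop (fwd (cv _)) _ (hop (bwd (cv _)) _ (hop (bwd (bc _)) _ end)))) _
       (_ , _ , Qc , _) = inj₂ Qc
    go (hop (fwd (bc _)) _ (hop (fwd (cv _)) _ (hop (bwd uv) _ (hop (fwd ()) _ end)))) _ _
    go (hop (fwd (bc _)) _ (hop (fwd (cv _)) _ (hop (bwd uv) _ (hop (bwd ()) _ end)))) _ _
    go (hop (fwd (bc _)) _ (hop (bwd (bc _)) _ (hop (bwd (ab _)) _ (hop (fwd (ab _)) _ end)))) _ _ =
      ⊥-elim (i≢j refl)
    go (hop (fwd (bc _)) _ (hop (bwd (bc _)) _ (hop (fwd (bc _)) _ (hop (bwd (bc _)) _ end)))) _ _ =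
      ⊥-elim (i≢j refl)

Vertex : ℕ → Set
Vertex n = Fin (2 + 3 * n)

module Graph (n : ℕ) where

  nodeOf : Vertex n → Node
  nodeOf x = node (toℕ x)

  index-nodeOf : ∀ x → index (nodeOf x) ≡ toℕ x
  index-nodeOf x = index-node (toℕ x)

  nodeOf-injective : ∀ {x y} → nodeOf x ≡ nodeOf y → x ≡ y
  nodeOf-injective {x} {y} eq =
    toℕ-injective (trans (sym (index-nodeOf x)) (trans (cong index eq) (index-nodeOf y)))

  3+3*i≤3*n : ∀ {i} → i < n → 3 + 3 * i ≤ 3 * n
  3+3*i≤3*n {i} i<n = subst (_≤ 3 * n) (*-suc 3 i) (*-monoʳ-≤ 3 i<n)

  index<-valid : ∀ p → Valid n p → index p < 2 + 3 * n
  index<-valid u     _   = s≤s z≤n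
  index<-valid v     _   = s≤s (s≤s z≤n)
  index<-valid (a i) i<n = s≤s (s≤s (≤-trans (m≤n+m (1 + 3 * i) 2) (3+3*i≤3*n i<n)))
  index<-valid (b i) i<n = s≤s (s≤s (≤-trans (m≤n+m (2 + 3 * i) 1) (3+3*i≤3*n i<n)))
  index<-valid (c i) i<n = s≤s (s≤s (3+3*i≤3*n i<n))

  valid-index< : ∀ p → index p < 2 + 3 * n → Valid n p
  valid-index< u     _                 = tt
  valid-index< v     _                 = tt
  valid-index< (a i) (s≤s (s≤s 3i<3n)) = *-cancelˡ-< 3 i n 3i<3n
  valid-index< (b i) (s≤s (s≤s 3i<3n)) = *-cancelˡ-< 3 i n (≤-trans (n≤1+n _) 3i<3n)
  valid-index< (c i) (s≤s (s≤s 3i<3n)) =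
    *-cancelˡ-< 3 i n (≤-trans (≤-trans (n≤1+n _) (n≤1+n _)) 3i<3n)

  nodeOf-valid : ∀ x → Valid n (nodeOf x)
  nodeOf-valid x = valid-index< (nodeOf x) (subst (_< 2 + 3 * n) (sym (index-nodeOf x)) (toℕ<n x))

  vertex : ∀ p → Valid n p → Vertex n
  vertex p vp = fromℕ< (index<-valid p vp)

  nodeOf-vertex : ∀ {p} (vp : Valid n p) → nodeOf (vertex p vp) ≡ p
  nodeOf-vertex {p} vp = trans (cong node (toℕ-fromℕ< (index<-valid p vp))) (node-index p)

  edge-nodes : ∀ {P Q} → GEdge n P Q → Edge (node P) (node Q)
  edge-nodes e-uv       = uv
  edge-nodes (e-ua i _) = subst (Edge u) (sym (node-index (a i))) (ua i)
  edge-nodes (e-ab i _) = subst₂ Edge (sym (node-index (a i))) (sym (node-index (b i))) (ab i)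
  edge-nodes (e-bc i _) = subst₂ Edge (sym (node-index (b i))) (sym (node-index (c i))) (bc i)
  edge-nodes (e-cv i _) = subst (λ p → Edge p v) (sym (node-index (c i))) (cv i)

  edge-GEdge : ∀ {p q} → Edge p q → Valid n p → Valid n q → GEdge n (index p) (index q)
  edge-GEdge uv     _   _   = e-uv
  edge-GEdge (ua i) _   i<n = e-ua i i<n
  edge-GEdge (ab i) i<n _   = e-ab i i<n
  edge-GEdge (bc i) i<n _   = e-bc i i<n
  edge-GEdge (cv i) i<n _   = e-cv i i<n

  GAdj⇒adjacent : ∀ {x y} → GAdj n x y → Adjacent (nodeOf x) (nodeOf y)
  GAdj⇒adjacent (inj₁ e) = fwd (edge-nodes e)
  GAdj⇒adjacent (inj₂ e) = bwd (edge-nodes e)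

  adjacent⇒GAdj : ∀ {x y} → Adjacent (nodeOf x) (nodeOf y) → GAdj n x y
  adjacent⇒GAdj {x} {y} (fwd e) =
    inj₁ (subst₂ (GEdge n) (index-nodeOf x) (index-nodeOf y)
      (edge-GEdge e (nodeOf-valid x) (nodeOf-valid y)))
  adjacent⇒GAdj {x} {y} (bwd e) =
    inj₂ (subst₂ (GEdge n) (index-nodeOf y) (index-nodeOf x)
      (edge-GEdge e (nodeOf-valid y) (nodeOf-valid x)))

  Occupied : Subset (2 + 3 * n) → Node → Set
  Occupied X p = ∃ λ z → nodeOf z ≡ p × z ∈ X

  Vacant : Subset (2 + 3 * n) → Node → Set
  Vacant X p = ¬ Occupied X p

  route : ∀ {x y} → Walk (GAdj n) x y → Route n (nodeOf x) (nodeOf y)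
  route (stop _)         = end
  route (step x {y} e w) = hop (GAdj⇒adjacent {x} {y} e) (nodeOf-valid y) (route w)

  length-route : ∀ {x y} (w : Walk (GAdj n) x y) → length (route w) ≡ len (GAdj n) w
  length-route (stop _)     = refl
  length-route (step _ _ w) = cong suc (length-route w)

  route-allButLast : ∀ X {x y} (w : Walk (GAdj n) x y) →
                     AllButLastOutside (GAdj n) X w → AllButLast (Vacant X) (route w)
  route-allButLast X (stop _)     _           = tt
  route-allButLast X (step x _ w) (x∉X , w∉X) =
    (λ (z , z≡x , z∈X) → x∉X (subst (_∈ X) (nodeOf-injective {z} {x} z≡x) z∈X)) ,
    route-allButLast X w w∉X

  route-interior : ∀ X {x y} (w : Walk (GAdj n) x y) →
                   NoInternalIn (GAdj n) X w → AllInterior (Vacant X) (route w)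
  route-interior X (stop _)     _ = tt
  route-interior X (step _ _ w) i = route-allButLast X w i

  lift : ∀ {p q} (ρ : Route n p q) x y → nodeOf x ≡ p → nodeOf y ≡ q → Walk (GAdj n) x y
  lift end x y refl y≡x with nodeOf-injective {y} {x} y≡x
  ... | refl = stop x
  lift (hop {q = q} e vq ρ) x y refl y≡ =
    step x (adjacent⇒GAdj {x} {vertex q vq} (subst (Adjacent _) (sym (nodeOf-vertex vq)) e))
      (lift ρ (vertex q vq) y (nodeOf-vertex vq) y≡)

  len-lift : ∀ {p q} (ρ : Route n p q) x y (x≡ : nodeOf x ≡ p) (y≡ : nodeOf y ≡ q) →
             len (GAdj n) (lift ρ x y x≡ y≡) ≡ length ρ
  len-lift end x y refl y≡x with nodeOf-injective {y} {x} y≡x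
  ... | refl = refl
  len-lift (hop {q = q} e vq ρ) x y refl y≡ = cong suc (len-lift ρ (vertex q vq) y (nodeOf-vertex vq) y≡)

  module _ (X : Subset (2 + 3 * n)) {Q : Node → Set} (Q⇒∉ : ∀ z → Q (nodeOf z) → z ∉ X) where

    lift-allButLast : ∀ {p q} (ρ : Route n p q) x y (x≡ : nodeOf x ≡ p) (y≡ : nodeOf y ≡ q) →
                      AllButLast Q ρ → AllButLastOutside (GAdj n) X (lift ρ x y x≡ y≡)
    lift-allButLast end x y refl y≡x _ with nodeOf-injective {y} {x} y≡x
    ... | refl = tt
    lift-allButLast (hop {q = q} e vq ρ) x y refl y≡ (Qx , Qρ) =
      Q⇒∉ x Qx , lift-allButLast ρ (vertex q vq) y (nodeOf-vertex vq) y≡ Qρ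

    lift-interior : ∀ {p q} (ρ : Route n p q) x y (x≡ : nodeOf x ≡ p) (y≡ : nodeOf y ≡ q) →
                    AllInterior Q ρ → NoInternalIn (GAdj n) X (lift ρ x y x≡ y≡)
    lift-interior end x y refl y≡x _ with nodeOf-injective {y} {x} y≡x
    ... | refl = tt
    lift-interior (hop {q = q} e vq ρ) x y refl y≡ =
      lift-allButLast ρ (vertex q vq) y (nodeOf-vertex vq) y≡

  geodesic-walk : ∀ x y → Σ (Walk (GAdj n) x y) λ w → len (GAdj n) w ≡ dist (nodeOf x) (nodeOf y)
  geodesic-walk x y with geodesic {n} (nodeOf x) (nodeOf y) (nodeOf-valid x) (nodeOf-valid y)
  ... | ρ , ℓ = lift ρ x y refl refl , trans (len-lift ρ x y refl refl) ℓ

  dist≤len : ∀ {x y} (w : Walk (GAdj n) x y) → dist (nodeOf x) (nodeOf y) ≤ len (GAdj n) w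
  dist≤len w = subst (_ ≤_) (length-route w) (dist≤length (route w))

  len≡dist⇒shortest : ∀ {x y} (w : Walk (GAdj n) x y) →
                      len (GAdj n) w ≡ dist (nodeOf x) (nodeOf y) → IsShortest (GAdj n) w
  len≡dist⇒shortest w ℓ w′ = subst (_≤ len (GAdj n) w′) (sym ℓ) (dist≤len w′)

  shortest⇒len≡dist : ∀ {x y} (w : Walk (GAdj n) x y) →
                      IsShortest (GAdj n) w → len (GAdj n) w ≡ dist (nodeOf x) (nodeOf y)
  shortest⇒len≡dist {x} {y} w shortest with geodesic-walk x y
  ... | w′ , ℓ = ≤-antisym (≤-trans (shortest w′) (≤-reflexive ℓ)) (dist≤len w)

  ClearGeodesic : Subset (2 + 3 * n) → Node → Node → Set
  ClearGeodesic X = GeodesicWithin {n} (Vacant X)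

  visible⇒clearGeodesic : ∀ X {x y} → Visible (GAdj n) X x y → ClearGeodesic X (nodeOf x) (nodeOf y)
  visible⇒clearGeodesic X (w , shortest , clear) =
    geodesicWithin (route w)
      (trans (length-route w) (shortest⇒len≡dist w shortest))
      (route-interior X w clear)

  geodesicWithin⇒visible : ∀ X {Q} → (∀ z → Q (nodeOf z) → z ∉ X) →
                           ∀ {x y} → GeodesicWithin {n} Q (nodeOf x) (nodeOf y) → Visible (GAdj n) X x y
  geodesicWithin⇒visible X Q⇒∉ {x} {y} (geodesicWithin ρ ℓ interior) =
    lift ρ x y refl refl ,
    len≡dist⇒shortest _ (trans (len-lift ρ x y refl refl) ℓ) ,
    lift-interior X Q⇒∉ ρ x y refl refl interior

  occupied-valid : ∀ {X p} → Occupied X p → Valid n p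
  occupied-valid (z , refl , _) = nodeOf-valid z

  occupied⇒vertex∈ : ∀ {X p} (vp : Valid n p) → Occupied X p → vertex p vp ∈ X
  occupied⇒vertex∈ {X} vp (z , z≡p , z∈X) =
    subst (_∈ X) (nodeOf-injective {z} (trans z≡p (sym (nodeOf-vertex vp)))) z∈X

  occupied? : ∀ X {p} → Valid n p → Dec (Occupied X p)
  occupied? X {p} vp with vertex p vp ∈? X
  ... | yes v∈X = yes (vertex p vp , nodeOf-vertex vp , v∈X)
  ... | no v∉X  = no λ occ → v∉X (occupied⇒vertex∈ vp occ)

  dualMV⇒clearGeodesic : ∀ {X} → IsDualMV (GAdj n) X → ∀ {p q} (vp : Valid n p) (vq : Valid n q) →
                         Agree (Occupied X p) (Occupied X q) → ClearGeodesic X p q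
  dualMV⇒clearGeodesic {X} (in-in , out-out) {p} {q} vp vq sides =
    subst₂ (ClearGeodesic X) (nodeOf-vertex vp) (nodeOf-vertex vq)
      (visible⇒clearGeodesic X (visible sides))
    where
    visible : Agree (Occupied X p) (Occupied X q) → Visible (GAdj n) X (vertex p vp) (vertex q vq)
    visible (inj₁ (occ-p , occ-q)) = in-in _ _ (occupied⇒vertex∈ vp occ-p) (occupied⇒vertex∈ vq occ-q)
    visible (inj₂ (vac-p , vac-q)) =
      out-out _ _ (λ v∈ → vac-p (_ , nodeOf-vertex vp , v∈)) (λ v∈ → vac-q (_ , nodeOf-vertex vq , v∈))

length≤1⇒AllInterior : ∀ {n p q Q} (ρ : Route n p q) → length ρ ≤ 1 → AllInterior Q ρ
length≤1⇒AllInterior end                 _             = tt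
length≤1⇒AllInterior (hop _ _ end)       _             = tt
length≤1⇒AllInterior (hop _ _ (hop _ _ _)) (s≤s ())

adjacent⇒dist≤1 : ∀ {p q} → Adjacent p q → dist p q ≤ 1
adjacent⇒dist≤1 {p} {q} e = subst (λ d → dist p q ≤ suc d) (dist-self q) (dist-adjacent e q)

InX₀ : Node → Set
InX₀ p = p ≡ a 0 ⊎ p ≡ b 0

OutX₀ : Node → Set
OutX₀ (a zero) = ⊥
OutX₀ (b zero) = ⊥
OutX₀ _        = ⊤

outX₀? : ∀ p → OutX₀ p ⊎ InX₀ p
outX₀? u           = inj₁ tt
outX₀? v           = inj₁ tt
outX₀? (a zero)    = inj₂ (inj₁ refl)
outX₀? (a (suc _)) = inj₁ tt
outX₀? (b zero)    = inj₂ (inj₂ refl)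
outX₀? (b (suc _)) = inj₁ tt
outX₀? (c _)       = inj₁ tt

OutX₀-b⇒a : ∀ j → OutX₀ (b j) → OutX₀ (a j)
OutX₀-b⇒a (suc _) _ = tt

OutX₀-a⇒b : ∀ j → OutX₀ (a j) → OutX₀ (b j)
OutX₀-a⇒b (suc _) _ = tt

InX₀-dist≤1 : ∀ {p q} → InX₀ p → InX₀ q → dist p q ≤ 1
InX₀-dist≤1 (inj₁ refl) (inj₁ refl) = subst (_≤ 1) (sym (dist-self (a 0))) z≤n
InX₀-dist≤1 (inj₁ refl) (inj₂ refl) = adjacent⇒dist≤1 (fwd (ab 0))
InX₀-dist≤1 (inj₂ refl) (inj₁ refl) = adjacent⇒dist≤1 (bwd (ab 0))
InX₀-dist≤1 (inj₂ refl) (inj₂ refl) = subst (_≤ 1) (sym (dist-self (b 0))) z≤n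

geodesic-avoids-X₀ : ∀ {n} p q (vp : Valid n p) (vq : Valid n q) →
                     OutX₀ p → OutX₀ q → AllInterior OutX₀ (proj₁ (geodesic p q vp vq))
geodesic-avoids-X₀ u     u     _  _  _  _  = tt
geodesic-avoids-X₀ u     v     _  _  _  _  = tt
geodesic-avoids-X₀ u     (a j) _  _  _  _  = tt
geodesic-avoids-X₀ u     (b j) _  _  _  oq = OutX₀-b⇒a j oq , tt
geodesic-avoids-X₀ u     (c j) _  _  _  _  = tt , tt
geodesic-avoids-X₀ v     u     _  _  _  _  = tt
geodesic-avoids-X₀ v     v     _  _  _  _  = tt
geodesic-avoids-X₀ v     (a j) _  _  _  _  = tt , tt
geodesic-avoids-X₀ v     (b j) _  _  _  _  = tt , tt
geodesic-avoids-X₀ v     (c j) _  _  _  _  = tt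
geodesic-avoids-X₀ (a i) u     _  _  _  _  = tt
geodesic-avoids-X₀ (a i) v     _  _  _  _  = tt , tt
geodesic-avoids-X₀ (a i) (a j) vp vq op oq with i ≟ᶜ j
... | yes refl = tt
... | no _     = tt , tt
geodesic-avoids-X₀ (a i) (b j) vp vq op oq with i ≟ᶜ j
... | yes refl = tt
... | no _     = tt , OutX₀-b⇒a j oq , tt
geodesic-avoids-X₀ (a i) (c j) vp vq op oq with i ≟ᶜ j
... | yes refl = OutX₀-a⇒b i op , tt
... | no _     = tt , tt , tt
geodesic-avoids-X₀ (b i) u     _  _  op _  = OutX₀-b⇒a i op , tt
geodesic-avoids-X₀ (b i) v     _  _  _  _  = tt , tt
geodesic-avoids-X₀ (b i) (a j) vp vq op oq with i ≟ᶜ j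
... | yes refl = tt
... | no _     = OutX₀-b⇒a i op , tt , tt
geodesic-avoids-X₀ (b i) (b j) vp vq op oq with i ≟ᶜ j
... | yes refl = tt
... | no _     = tt , tt , tt , tt
geodesic-avoids-X₀ (b i) (c j) vp vq op oq with i ≟ᶜ j
... | yes refl = tt
... | no _     = tt , tt , tt
geodesic-avoids-X₀ (c i) u     _  _  _  _  = tt , tt
geodesic-avoids-X₀ (c i) v     _  _  _  _  = tt
geodesic-avoids-X₀ (c i) (a j) vp vq op oq with i ≟ᶜ j
... | yes refl = OutX₀-a⇒b i oq , tt
... | no _     = tt , tt , tt
geodesic-avoids-X₀ (c i) (b j) vp vq op oq with i ≟ᶜ j
... | yes refl = tt
... | no _     = tt , tt , tt
geodesic-avoids-X₀ (c i) (c j) vp vq op oq with i ≟ᶜ j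
... | yes refl = tt
... | no _     = tt , tt

Agree₀ : Node → Node → Set
Agree₀ p q = (InX₀ p × InX₀ q) ⊎ (OutX₀ p × OutX₀ q)

geodesic-avoiding-X₀ : ∀ {n p q} (vp : Valid n p) (vq : Valid n q) →
                       Agree₀ p q → GeodesicWithin {n} OutX₀ p q
geodesic-avoiding-X₀ {n} {p} {q} vp vq sides = geodesicWithin ρ ℓ (avoiding sides)
  where
  ρ = proj₁ (geodesic {n} p q vp vq)
  ℓ = proj₂ (geodesic {n} p q vp vq)
  avoiding : Agree₀ p q → AllInterior OutX₀ ρ
  avoiding (inj₁ (p∈ , q∈)) = length≤1⇒AllInterior ρ (≤-trans (≤-reflexive ℓ) (InX₀-dist≤1 p∈ q∈))
  avoiding (inj₂ (p∉ , q∉)) = geodesic-avoids-X₀ p q vp vq p∉ q∉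

module LowerBound (k : ℕ) where

  n : ℕ
  n = 2 + k

  open Graph n

  X₀ : Subset (2 + 3 * n)
  X₀ = outside ∷ outside ∷ inside ∷ inside ∷ ∅

  ∣X₀∣≡2 : ∣ X₀ ∣ ≡ 2
  ∣X₀∣≡2 = cong (2 +_) (∣⊥∣≡0 (k + 2 * n))

  ∈X₀⇒InX₀ : ∀ x → x ∈ X₀ → InX₀ (nodeOf x)
  ∈X₀⇒InX₀ fzero                        ()
  ∈X₀⇒InX₀ (fsuc fzero)                 (there ())
  ∈X₀⇒InX₀ (fsuc (fsuc fzero))          _ = inj₁ refl
  ∈X₀⇒InX₀ (fsuc (fsuc (fsuc fzero)))  _ = inj₂ refl
  ∈X₀⇒InX₀ (fsuc (fsuc (fsuc (fsuc x)))) (there (there (there (there x∈∅)))) = ⊥-elim (∉⊥ x∈∅)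

  InX₀⇒∈X₀ : ∀ x → InX₀ (nodeOf x) → x ∈ X₀
  InX₀⇒∈X₀ x (inj₁ x≡a₀) =
    subst (_∈ X₀) (nodeOf-injective {y = x} (sym x≡a₀)) (there (there here))
  InX₀⇒∈X₀ x (inj₂ x≡b₀) =
    subst (_∈ X₀) (nodeOf-injective {y = x} (sym x≡b₀)) (there (there (there here)))

  ∉X₀⇒OutX₀ : ∀ x → x ∉ X₀ → OutX₀ (nodeOf x)
  ∉X₀⇒OutX₀ x x∉ with outX₀? (nodeOf x)
  ... | inj₁ out = out
  ... | inj₂ in′ = ⊥-elim (x∉ (InX₀⇒∈X₀ x in′))

  OutX₀⇒∉X₀ : ∀ x → OutX₀ (nodeOf x) → x ∉ X₀
  OutX₀⇒∉X₀ x out x∈ with nodeOf x | ∈X₀⇒InX₀ x x∈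
  ... | _ | inj₁ refl = out
  ... | _ | inj₂ refl = out

  X₀-dualMV : IsDualMV (GAdj n) X₀
  X₀-dualMV = (λ x y x∈ y∈ → visible (inj₁ (∈X₀⇒InX₀ x x∈ , ∈X₀⇒InX₀ y y∈))) ,
              (λ x y x∉ y∉ → visible (inj₂ (∉X₀⇒OutX₀ x x∉ , ∉X₀⇒OutX₀ y y∉)))
    where
    visible : ∀ {x y} → Agree₀ (nodeOf x) (nodeOf y) → Visible (GAdj n) X₀ x y
    visible {x} {y} =
      geodesicWithin⇒visible X₀ OutX₀⇒∉X₀ ∘ geodesic-avoiding-X₀ (nodeOf-valid x) (nodeOf-valid y)

module UpperBound (k : ℕ) (X : Subset (2 + 3 * (2 + k))) (dualMV : IsDualMV (GAdj (2 + k)) X) where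

  n : ℕ
  n = 2 + k

  open Graph n

  clear : ∀ {p q} → Valid n p → Valid n q → Agree (Occupied X p) (Occupied X q) → ClearGeodesic X p q
  clear = dualMV⇒clearGeodesic dualMV

  0<n : 0 < n
  0<n = s≤s z≤n

  1<n : 1 < n
  1<n = s≤s (s≤s z≤n)

  u-vacant : Vacant X u
  u-vacant u-occ with pigeonhole-dec (occupied? X {a 0} 0<n) (occupied? X {a 1} 1<n) (occupied? X {v} tt)
  ... | inj₁ sides        = a-a-via-u (λ ()) (clear 0<n 1<n sides) u-occ
  ... | inj₂ (inj₁ sides) = a-v-via-u (clear 0<n tt sides) u-occ
  ... | inj₂ (inj₂ sides) = a-v-via-u (clear 1<n tt sides) u-occ

  v-vacant : Vacant X v
  v-vacant v-occ with pigeonhole-dec (occupied? X {c 0} 0<n) (occupied? X {c 1} 1<n) (occupied? X {u} tt)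
  ... | inj₁ sides        = c-c-via-v (λ ()) (clear 0<n 1<n sides) v-occ
  ... | inj₂ (inj₁ sides) = c-u-via-v (clear 0<n tt sides) v-occ
  ... | inj₂ (inj₂ sides) = c-u-via-v (clear 1<n tt sides) v-occ

  a⇒b : ∀ {i} → Occupied X (a i) → Occupied X (b i)
  a⇒b {i} aᵢ with occupied? X {b i} (occupied-valid aᵢ)
  ... | yes bᵢ = bᵢ
  ... | no ¬bᵢ = ⊥-elim (u-b-via-a (clear tt (occupied-valid aᵢ) (inj₂ (u-vacant , ¬bᵢ))) aᵢ)

  c⇒b : ∀ {i} → Occupied X (c i) → Occupied X (b i)
  c⇒b {i} cᵢ with occupied? X {b i} (occupied-valid cᵢ)
  ... | yes bᵢ = bᵢ
  ... | no ¬bᵢ = ⊥-elim (v-b-via-c (clear tt (occupied-valid cᵢ) (inj₂ (v-vacant , ¬bᵢ))) cᵢ)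

  b⇒a⊎c : ∀ {i} → Occupied X (b i) → Occupied X (a i) ⊎ Occupied X (c i)
  b⇒a⊎c {i} bᵢ with occupied? X {a i} (occupied-valid bᵢ) | occupied? X {c i} (occupied-valid bᵢ)
  ... | yes aᵢ | _      = inj₁ aᵢ
  ... | no _   | yes cᵢ = inj₂ cᵢ
  ... | no ¬aᵢ | no ¬cᵢ =
    ⊥-elim (a-c-via-b (clear (occupied-valid bᵢ) (occupied-valid bᵢ) (inj₂ (¬aᵢ , ¬cᵢ))) bᵢ)

  ¬a×c : ∀ {i} → Occupied X (a i) → Occupied X (c i) → ⊥
  ¬a×c aᵢ cᵢ = a-c-via-b (clear (occupied-valid aᵢ) (occupied-valid cᵢ) (inj₁ (aᵢ , cᵢ))) (a⇒b aᵢ)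

  a-c-apart : ∀ {i j} → i ≢ j → Occupied X (b i) → Occupied X (b j) →
              Occupied X (a i) → Occupied X (c j) → ⊥
  a-c-apart i≢j bᵢ bⱼ aᵢ cⱼ =
    [ (λ ¬aᵢ → ¬aᵢ aᵢ) , (λ ¬cⱼ → ¬cⱼ cⱼ) ]
      (b-b-via-a⊎c i≢j (clear (occupied-valid bᵢ) (occupied-valid bⱼ) (inj₁ (bᵢ , bⱼ))))

  b-unique : ∀ {i j} → Occupied X (b i) → Occupied X (b j) → i ≡ j
  b-unique {i} {j} bᵢ bⱼ = decidable-stable (i ≟ j) (λ i≢j → apart i≢j (b⇒a⊎c bᵢ) (b⇒a⊎c bⱼ))
    where
    apart : i ≢ j → Occupied X (a i) ⊎ Occupied X (c i) → Occupied X (a j) ⊎ Occupied X (c j) → ⊥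
    apart i≢j (inj₁ aᵢ) (inj₁ aⱼ) =
      a-b-via-a i≢j (clear (occupied-valid aᵢ) (occupied-valid bⱼ) (inj₁ (aᵢ , bⱼ))) aⱼ
    apart i≢j (inj₂ cᵢ) (inj₂ cⱼ) =
      c-b-via-c i≢j (clear (occupied-valid cᵢ) (occupied-valid bⱼ) (inj₁ (cᵢ , bⱼ))) cⱼ
    apart i≢j (inj₁ aᵢ) (inj₂ cⱼ) = a-c-apart i≢j bᵢ bⱼ aᵢ cⱼ
    apart i≢j (inj₂ cᵢ) (inj₁ aⱼ) = a-c-apart (i≢j ∘ sym) bⱼ bᵢ aⱼ cᵢ

  cycle-of : ∀ {r} → Occupied X r → ∃ λ i → Occupied X (b i)
  cycle-of {u}   u-occ = ⊥-elim (u-vacant u-occ)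
  cycle-of {v}   v-occ = ⊥-elim (v-vacant v-occ)
  cycle-of {a i} aᵢ    = i , a⇒b aᵢ
  cycle-of {b i} bᵢ    = i , bᵢ
  cycle-of {c i} cᵢ    = i , c⇒b cᵢ

  in-cycle : ∀ {i s} → Occupied X (b i) → Occupied X s → s ≡ a i ⊎ s ≡ b i ⊎ s ≡ c i
  in-cycle {s = u}   _  u-occ = ⊥-elim (u-vacant u-occ)
  in-cycle {s = v}   _  v-occ = ⊥-elim (v-vacant v-occ)
  in-cycle {s = a j} bᵢ aⱼ    = inj₁ (cong a (b-unique (a⇒b aⱼ) bᵢ))
  in-cycle {s = b j} bᵢ bⱼ    = inj₂ (inj₁ (cong b (b-unique bⱼ bᵢ)))
  in-cycle {s = c j} bᵢ cⱼ    = inj₂ (inj₂ (cong c (b-unique (c⇒b cⱼ) bᵢ)))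

  occupied-within-pair : ∀ {r} → Occupied X r →
                         Σ Node λ p → Σ Node λ q → ∀ {s} → Occupied X s → s ≡ p ⊎ s ≡ q
  occupied-within-pair r-occ with cycle-of r-occ
  ... | i , bᵢ with occupied? X {a i} (occupied-valid bᵢ)
  ... | yes aᵢ = a i , b i , λ s-occ → a-or-b (in-cycle bᵢ s-occ) s-occ
    where
    a-or-b : ∀ {s} → s ≡ a i ⊎ s ≡ b i ⊎ s ≡ c i → Occupied X s → s ≡ a i ⊎ s ≡ b i
    a-or-b (inj₁ s≡a)        _  = inj₁ s≡a
    a-or-b (inj₂ (inj₁ s≡b)) _  = inj₂ s≡b
    a-or-b (inj₂ (inj₂ refl)) cᵢ = ⊥-elim (¬a×c aᵢ cᵢ)
  ... | no ¬aᵢ = b i , c i , λ s-occ → b-or-c (in-cycle bᵢ s-occ) s-occ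
    where
    b-or-c : ∀ {s} → s ≡ a i ⊎ s ≡ b i ⊎ s ≡ c i → Occupied X s → s ≡ b i ⊎ s ≡ c i
    b-or-c (inj₁ refl)       aᵢ = ⊥-elim (¬aᵢ aᵢ)
    b-or-c (inj₂ (inj₁ s≡b)) _  = inj₁ s≡b
    b-or-c (inj₂ (inj₂ s≡c)) _  = inj₂ s≡c

  ∣X∣≤2 : ∣ X ∣ ≤ 2
  ∣X∣≤2 = ∣p∣≤2 X λ x∈ y∈ z∈ → TwoEqual-injective {f = nodeOf} nodeOf-injective (nodes-collide x∈ y∈ z∈)
    where
    nodes-collide : ∀ {x y z} → x ∈ X → y ∈ X → z ∈ X → TwoEqual (nodeOf x) (nodeOf y) (nodeOf z)
    nodes-collide {x} {y} {z} x∈ y∈ z∈ with occupied-within-pair (x , refl , x∈)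
    ... | _ , _ , within =
      pigeonhole-pair (within (x , refl , x∈)) (within (y , refl , y∈)) (within (z , refl , z∈))

proposition2p5 : (n : ℕ) → 2 ≤ n → μd≡ (GAdj n) 2
proposition2p5 (suc (suc k)) (s≤s (s≤s z≤n)) =
  (X₀ , X₀-dualMV , ∣X₀∣≡2) , λ X dualMV → UpperBound.∣X∣≤2 k X dualMV
  where open LowerBound k
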